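{- Let $q=Q^e$, where $Q=p^d$ is a power of a prime $p$ and $d,e$ are positive integers, and let $\alpha$ and $\beta$ be generators of the cyclic group $\mathbb{F}_q^*$. Let $r=\frac{Q^e-1}{Q-1}$. Suppose that for some integers $i$ and $j$ we have $\alpha^i+\beta^j=1$ in $\mathbb{F}_q$. Then $r$ divides $i$ if and only if $r$ divides $j$.
   Context: $\mathbb{F}_q$ denotes the finite field with $q$ elements and $\mathbb{F}_q^*$ its multiplicative group of non-zero elements. -}

module Defs where

open import Level using (Level; _⊔_)
open import Algebra.Bundles using (CommutativeRing)
open import Data.Nat as ℕ using (ℕ; zero; suc)
open import Data.Integer as ℤ using (ℤ; +_; -[1+_])
open import Data.Fin using (Fin)
open import Data.Product using (∃; _×_)
open import Relation.Nullary using (¬_)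
open import Function.Bundles using (Inverse)
import Relation.Binary.PropositionalEquality as ≡

record FiniteField (c ℓ : Level) (q : ℕ) : Set (Level.suc (c ⊔ ℓ)) where
  field
    commRing : CommutativeRing c ℓ
  open CommutativeRing commRing public
  field
    _⁻¹     : Carrier → Carrier
    1≉0     : ¬ (1# ≈ 0#)
    inverse : ∀ x → ¬ (x ≈ 0#) → x * (x ⁻¹) ≈ 1#
    card    : Inverse (≡.setoid (Fin q)) setoid

  infix 8 _⁻¹

  _^ℕ_ : Carrier → ℕ → Carrier
  x ^ℕ zero  = 1#
  x ^ℕ suc n = x * (x ^ℕ n)

  _^ℤ_ : Carrier → ℤ → Carrier
  x ^ℤ (+ n)      = x ^ℕ n
  x ^ℤ -[1+ n ]   = (x ^ℕ suc n) ⁻¹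

  IsGenerator : Carrier → Set (c ⊔ ℓ)
  IsGenerator x = ¬ (x ≈ 0#) × (∀ y → ¬ (y ≈ 0#) → ∃ λ (n : ℕ) → y ≈ x ^ℕ n)

module Submission where

-- Let q = Q ^ e with Q = p ^ d, let n = q - 1 = r · (Q - 1), and let α, β generate
-- the cyclic group F_q^*.  The subfield F_Q of F_q is the set of fixed points of
-- the map x ↦ x ^ Q, and for a generator α
--     α ^ a ∈ F_Q  ⇔  α ^ (a · (Q - 1)) = 1  ⇔  n ∣ a · (Q - 1)  ⇔  r ∣ a.
-- Since F_q has characteristic p, x ↦ x ^ Q is additive (an iterated Frobenius),
-- so its fixed points are closed under y ↦ 1 - y.  Hence if α ^ i + β ^ j = 1 and
-- r ∣ i, then β ^ j = 1 - α ^ i lies in F_Q, i.e. r ∣ j; and symmetrically.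

open import Defs
open import Level using (Level)
open import Algebra.Bundles using (CommutativeRing)
open import Data.Nat as ℕ using (ℕ; zero; suc; _∸_; _/_; _≥_; _<_; _≤_; _!; NonZero; z≤n; s≤s)
import Data.Nat.Properties as ℕP
open ℕP using (_!*_!≢0)
open import Data.Nat.Divisibility as ℕ∣ using (divides; _∣0)
open import Data.Nat.Primality using (Prime; euclidsLemma)
open import Data.Nat.Combinatorics using (_C_; nCn≡1; nCk≡n!/k![n-k]!; k![n∸k]!∣n!)
open import Data.Nat.DivMod using (m/n*n≡m)
open import Data.Sum using (inj₁; inj₂)
open import Data.Integer using (ℤ; +_)
open import Data.Integer.Divisibility using (_∣_)
open import Function.Bundles using (_⇔_)
open import Data.Empty using (⊥-elim)
open import Relation.Nullary using (¬_)
open import Relation.Binary.PropositionalEquality as ≡ using (_≡_; _≢_)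

prime∤! : ∀ {p} → Prime p → ∀ m → m < p → ¬ p ℕ∣.∣ m !
prime∤! {p} p-prime zero _ p∣1 with ℕ∣.∣1⇒≡1 p∣1
prime∤! {.1} () zero _ p∣1 | ≡.refl
prime∤! p-prime (suc m) m<p p∣m! with euclidsLemma (suc m) (m !) p-prime p∣m!
... | inj₁ p∣1+m = ℕP.<⇒≱ m<p (ℕ∣.∣⇒≤ p∣1+m)
... | inj₂ p∣m!  = prime∤! p-prime m (ℕP.<-trans (ℕP.n<1+n m) m<p) p∣m!

-- A prime p divides p C k for 0 < k < p: it divides p! = (p C k) · k! · (p ∸ k)!
-- but neither factorial on the right.
prime∣binomial : ∀ {p k} → Prime p → 0 < k → k < p → p ℕ∣.∣ p C k
prime∣binomial {p@(suc p′)} {k} p-prime 0<k k<p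
  with euclidsLemma (p C k) (k ! ℕ.* (p ∸ k) !) p-prime p∣product
  where
  instance _ = k !* (p ∸ k) !≢0
  k≤p = ℕP.<⇒≤ k<p
  product≡p! : (p C k) ℕ.* (k ! ℕ.* (p ∸ k) !) ≡ p !
  product≡p! = ≡.trans (≡.cong (ℕ._* (k ! ℕ.* (p ∸ k) !)) (nCk≡n!/k![n-k]! k≤p)) (m/n*n≡m (k![n∸k]!∣n! k≤p))
  p∣product : p ℕ∣.∣ (p C k) ℕ.* (k ! ℕ.* (p ∸ k) !)
  p∣product = ≡.subst (p ℕ∣.∣_) (≡.sym product≡p!) (ℕ∣.m∣m*n (p′ !))
... | inj₁ p∣pCk = p∣pCk
... | inj₂ p∣k![p-k]! with euclidsLemma (k !) ((p ∸ k) !) p-prime p∣k![p-k]!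
...   | inj₁ p∣k!     = ⊥-elim (prime∤! p-prime k k<p p∣k!)
...   | inj₂ p∣[p-k]! = ⊥-elim (prime∤! p-prime (p ∸ k) (ℕP.∸-monoʳ-< 0<k (ℕP.<⇒≤ k<p)) p∣[p-k]!)

-- Q - 1 divides Q ^ e - 1, since Q ^ (e + 1) - 1 = (Q ^ e - 1) + (Q - 1) · Q ^ e.
pred∣pred-pow : ∀ N e → N ℕ∣.∣ suc N ℕ.^ e ∸ 1
pred∣pred-pow N zero = N ∣0
pred∣pred-pow N (suc e) = ≡.subst (N ℕ∣.∣_) (≡.sym split) (ℕ∣.∣m∣n⇒∣m+n (pred∣pred-pow N e) (ℕ∣.m∣m*n Qᵉ))
  where
  Qᵉ = suc N ℕ.^ e
  split : suc N ℕ.* Qᵉ ∸ 1 ≡ (Qᵉ ∸ 1) ℕ.+ N ℕ.* Qᵉ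
  split = ℕP.+-∸-comm (N ℕ.* Qᵉ) (ℕP.m^n>0 (suc N) e)

module AdditivePowers {c ℓ} (R : CommutativeRing c ℓ) where
  open CommutativeRing R
  open import Algebra.Properties.CommutativeSemiring.Exp commutativeSemiring using (_^_; ^-congˡ; ^-assocʳ)
  open import Algebra.Properties.CommutativeSemiring.Binomial commutativeSemiring using (theorem; binomialTerm)
  open import Algebra.Properties.Semiring.Mult semiring using (_×_; ×-congʳ; ×-assocˡ; ×-assoc-*)
  open import Algebra.Properties.Semiring.Sum semiring using (sum; sum-cong-≋; sum-init-last; sum-replicate-zero)
  open import Algebra.Properties.Group +-group using (identityˡ-unique; inverseʳ-unique)
  open import Relation.Binary.Reasoning.Setoid setoid
  open import Data.Fin as Fin using (Fin; toℕ; inject₁; fromℕ)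
  import Data.Fin.Properties as FinP

  Additive : ℕ → Set (c Level.⊔ ℓ)
  Additive m = ∀ x y → (x + y) ^ m ≈ x ^ m + y ^ m

  1^m≈1 : ∀ m → 1# ^ m ≈ 1#
  1^m≈1 zero    = refl
  1^m≈1 (suc m) = trans (*-identityˡ _) (1^m≈1 m)

  additive-1 : Additive 1
  additive-1 x y = trans (*-identityʳ _) (+-cong (sym (*-identityʳ x)) (sym (*-identityʳ y)))

  additive-* : ∀ m n → Additive m → Additive n → Additive (m ℕ.* n)
  additive-* m n add-m add-n x y = begin
    (x + y) ^ (m ℕ.* n)           ≈⟨ ^-assocʳ (x + y) m n ⟨
    ((x + y) ^ m) ^ n             ≈⟨ ^-congˡ n (add-m x y) ⟩
    (x ^ m + y ^ m) ^ n           ≈⟨ add-n (x ^ m) (y ^ m) ⟩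
    (x ^ m) ^ n + (y ^ m) ^ n     ≈⟨ +-cong (^-assocʳ x m n) (^-assocʳ y m n) ⟩
    x ^ (m ℕ.* n) + y ^ (m ℕ.* n) ∎

  additive-^ : ∀ p → Additive p → ∀ d → Additive (p ℕ.^ d)
  additive-^ p add-p zero    = additive-1
  additive-^ p add-p (suc d) = additive-* p (p ℕ.^ d) add-p (additive-^ p add-p d)

  additive-neg : ∀ m → Additive m → ∀ x → (- x) ^ m ≈ - (x ^ m)
  additive-neg m add x = inverseʳ-unique (x ^ m) ((- x) ^ m) (begin
    x ^ m + (- x) ^ m ≈⟨ add x (- x) ⟨
    (x - x) ^ m       ≈⟨ ^-congˡ m (-‿inverseʳ x) ⟩
    0# ^ m            ≈⟨ 0^m≈0 ⟩
    0#                ∎)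
    where
    0^m≈0 : 0# ^ m ≈ 0#
    0^m≈0 = identityˡ-unique (0# ^ m) (0# ^ m) (begin
      0# ^ m + 0# ^ m ≈⟨ add 0# 0# ⟨
      (0# + 0#) ^ m   ≈⟨ ^-congˡ m (+-identityˡ 0#) ⟩
      0# ^ m          ∎)

  additive-fixed-1- : ∀ m → Additive m → ∀ y → y ^ m ≈ y → (1# - y) ^ m ≈ 1# - y
  additive-fixed-1- m add y y-fixed = begin
    (1# - y) ^ m       ≈⟨ add 1# (- y) ⟩
    1# ^ m + (- y) ^ m ≈⟨ +-cong (1^m≈1 m) (additive-neg m add y) ⟩
    1# - y ^ m         ≈⟨ +-congˡ (-‿cong y-fixed) ⟩
    1# - y             ∎

  multiple-vanishes : ∀ {p} → p × 1# ≈ 0# → ∀ a z → p ℕ∣.∣ a → a × z ≈ 0#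
  multiple-vanishes {p} char .(b ℕ.* p) z (divides b ≡.refl) = begin
    (b ℕ.* p) × z      ≈⟨ ×-assocˡ z b p ⟨
    b × (p × z)        ≈⟨ ×-congʳ b (×-congʳ p (*-identityˡ z)) ⟨
    b × (p × (1# * z)) ≈⟨ ×-congʳ b (×-assoc-* p 1# z) ⟨
    b × ((p × 1#) * z) ≈⟨ ×-congʳ b (trans (*-congʳ char) (zeroˡ z)) ⟩
    b × 0#             ≈⟨ zero-multiple b ⟩
    0#                 ∎
    where
    zero-multiple : ∀ b → b × 0# ≈ 0#
    zero-multiple zero    = refl
    zero-multiple (suc b) = trans (+-identityˡ _) (zero-multiple b)

  -- In the binomial expansion of (x + y) ^ p only the two outer terms survive,
  -- as every interior coefficient p C k is a multiple of p.
  frobenius : ∀ p → Prime p → p × 1# ≈ 0# → Additive p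
  frobenius p@(suc (suc m)) p-prime char x y = begin
    (x + y) ^ p                                   ≈⟨ theorem p x y ⟩
    term Fin.zero + sum (λ k → term (Fin.suc k))  ≈⟨ +-congˡ (sum-init-last (λ k → term (Fin.suc k))) ⟩
    term Fin.zero + (sum interior + term (fromℕ p)) ≈⟨ +-cong first-term (+-cong interior-vanishes last-term) ⟩
    y ^ p + (0# + x ^ p)                          ≈⟨ +-congˡ (+-identityˡ (x ^ p)) ⟩
    y ^ p + x ^ p                                 ≈⟨ +-comm (y ^ p) (x ^ p) ⟩
    x ^ p + y ^ p                                 ∎
    where
    term : Fin (suc p) → Carrier
    term = binomialTerm x y p
    interior : Fin (suc m) → Carrier
    interior k = term (Fin.suc (inject₁ k))
    first-term : term Fin.zero ≈ y ^ p
    first-term = trans (+-identityʳ _) (*-identityˡ _)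
    last-term : term (fromℕ p) ≈ x ^ p
    last-term = begin
      (p C toℕ (fromℕ p)) × (x ^ toℕ (fromℕ p) * y ^ (p ∸ toℕ (fromℕ p)))
        ≡⟨ ≡.cong (λ k → (p C k) × (x ^ k * y ^ (p ∸ k))) (FinP.toℕ-fromℕ p) ⟩
      (p C p) × (x ^ p * y ^ (p ∸ p))
        ≡⟨ ≡.cong₂ (λ a b → a × (x ^ p * y ^ b)) (nCn≡1 p) (ℕP.n∸n≡0 p) ⟩
      1 × (x ^ p * 1#)                            ≈⟨ +-identityʳ _ ⟩
      x ^ p * 1#                                  ≈⟨ *-identityʳ _ ⟩
      x ^ p                                       ∎
    interior-vanishes : sum interior ≈ 0#
    interior-vanishes = trans (sum-cong-≋ vanishes) (sum-replicate-zero (suc m))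
      where
      vanishes : ∀ k → interior k ≈ 0#
      vanishes k = multiple-vanishes char _ _ (prime∣binomial p-prime (s≤s z≤n) (s≤s k<1+m))
        where
        k<1+m : toℕ (inject₁ k) < suc m
        k<1+m = ≡.subst (_< suc m) (≡.sym (FinP.toℕ-inject₁ k)) (FinP.toℕ<n k)

module FiniteFieldFacts {c ℓ q} (F : FiniteField c ℓ q) where
  open FiniteField F
  open import Algebra.Properties.CommutativeSemiring.Exp commutativeSemiring using (_^_)
  open import Algebra.Properties.Semiring.Mult semiring using (_×_; ×1-homo-*)
  open import Algebra.Properties.CommutativeMonoid.Sum +-commutativeMonoid using (sum; sum-permute; sum-cong-≋; ∑-distrib-+; sum-replicate)
  open import Relation.Binary.Reasoning.Setoid setoid
  open import Data.Fin using (Fin)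
  import Data.Fin.Properties as FinP
  open import Data.Fin.Permutation using (Permutation; permutation)
  open import Function.Bundles using (Inverse)
  open import Relation.Nullary using (Dec; yes; no)

  open Inverse card public using (to; from) renaming (strictlyInverseˡ to to-from; strictlyInverseʳ to from-to)

  to-injective : ∀ {i j} → to i ≈ to j → i ≡ j
  to-injective {i} {j} to-i≈to-j = ≡.trans (≡.sym (from-to i)) (≡.trans (Inverse.from-cong card to-i≈to-j) (from-to j))

  from-injective : ∀ {x y} → from x ≡ from y → x ≈ y
  from-injective {x} {y} eq = begin x ≈⟨ to-from x ⟨ to (from x) ≡⟨ ≡.cong to eq ⟩ to (from y) ≈⟨ to-from y ⟩ y ∎

  _≟_ : ∀ x y → Dec (x ≈ y)
  x ≟ y with from x FinP.≟ from y
  ... | yes eq = yes (from-injective eq)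
  ... | no neq = no (λ x≈y → neq (Inverse.from-cong card x≈y))

  two≤q : 2 ℕ.≤ q
  two≤q = FinP.injective⇒≤ {f = index} index-injective
    where
    index : Fin 2 → Fin q
    index Fin.zero       = from 0#
    index (Fin.suc _)    = from 1#
    index-injective : ∀ {i j} → index i ≡ index j → i ≡ j
    index-injective {Fin.zero}        {Fin.zero}        _  = ≡.refl
    index-injective {Fin.zero}        {Fin.suc Fin.zero} eq = ⊥-elim (1≉0 (sym (from-injective eq)))
    index-injective {Fin.suc Fin.zero} {Fin.zero}        eq = ⊥-elim (1≉0 (from-injective eq))
    index-injective {Fin.suc Fin.zero} {Fin.suc Fin.zero} _  = ≡.refl

  ^ℕ≈^ : ∀ x n → x ^ℕ n ≈ x ^ n
  ^ℕ≈^ x zero    = refl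
  ^ℕ≈^ x (suc n) = *-congˡ (^ℕ≈^ x n)

  *-cancelˡ : ∀ {x y z} → ¬ x ≈ 0# → x * y ≈ x * z → y ≈ z
  *-cancelˡ {x} {y} {z} x≉0 xy≈xz = begin
    y               ≈⟨ *-identityˡ y ⟨
    1# * y          ≈⟨ *-congʳ (trans (*-comm (x ⁻¹) x) (inverse x x≉0)) ⟨
    x ⁻¹ * x * y    ≈⟨ *-assoc (x ⁻¹) x y ⟩
    x ⁻¹ * (x * y)  ≈⟨ *-congˡ xy≈xz ⟩
    x ⁻¹ * (x * z)  ≈⟨ *-assoc (x ⁻¹) x z ⟨
    x ⁻¹ * x * z    ≈⟨ *-congʳ (trans (*-comm (x ⁻¹) x) (inverse x x≉0)) ⟩
    1# * z          ≈⟨ *-identityˡ z ⟩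
    z               ∎

  *-nonzero : ∀ {x y} → ¬ x ≈ 0# → ¬ y ≈ 0# → ¬ x * y ≈ 0#
  *-nonzero {x} {y} x≉0 y≉0 xy≈0 = y≉0 (*-cancelˡ x≉0 (trans xy≈0 (sym (zeroʳ x))))

  ^-nonzero : ∀ {x} n → ¬ x ≈ 0# → ¬ x ^ n ≈ 0#
  ^-nonzero zero    x≉0 = 1≉0
  ^-nonzero (suc n) x≉0 = *-nonzero x≉0 (^-nonzero n x≉0)

  ^≈0⇒≈0 : ∀ {x} n → x ^ n ≈ 0# → x ≈ 0#
  ^≈0⇒≈0 {x} n xⁿ≈0 with x ≟ 0#
  ... | yes x≈0 = x≈0
  ... | no x≉0  = ⊥-elim (^-nonzero n x≉0 xⁿ≈0)

  inverse-unique : ∀ {x y} → x * y ≈ 1# → y ≈ x ⁻¹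
  inverse-unique {x} {y} xy≈1 with x ≟ 0#
  ... | yes x≈0 = ⊥-elim (1≉0 (trans (sym xy≈1) (trans (*-congʳ x≈0) (zeroˡ y))))
  ... | no x≉0  = *-cancelˡ x≉0 (trans xy≈1 (sym (inverse x x≉0)))

  -- q · 1 = 0: translation by 1 permutes F, so Σ x = Σ (x + 1) = Σ x + q · 1.
  card-vanishes : q × 1# ≈ 0#
  card-vanishes = identityʳ-unique S (q × 1#) (sym (begin
      S                                 ≈⟨ sum-permute to shift ⟩
      sum (λ i → to (from (to i + 1#))) ≈⟨ sum-cong-≋ (λ i → to-from (to i + 1#)) ⟩
      sum (λ i → to i + 1#)             ≈⟨ ∑-distrib-+ to (λ _ → 1#) ⟩
      S + sum {q} (λ _ → 1#)            ≈⟨ +-congˡ (sum-replicate q) ⟩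
      S + q × 1#                        ∎))
    where
    open import Algebra.Properties.Group +-group using (identityʳ-unique; //-rightDividesˡ; //-rightDividesʳ)
    S = sum to
    translate : Carrier → Fin q → Fin q
    translate a i = from (to i + a)
    translate-cancel : ∀ a b → (∀ x → x + b + a ≈ x) → ∀ i → translate a (translate b i) ≡ i
    translate-cancel a b cancel i = to-injective (trans (to-from _) (trans (+-congʳ (to-from _)) (cancel (to i))))
    shift : Permutation q q
    shift = permutation (translate 1#) (translate (- 1#))
      (translate-cancel 1# (- 1#) (//-rightDividesˡ 1#)) (translate-cancel (- 1#) 1# (//-rightDividesʳ 1#))

  -- If q = p ^ k then p · 1 = 0, because (p · 1) ^ k = q · 1 = 0 and F has no zero divisors.
  prime-power-characteristic : ∀ p k → q ≡ p ℕ.^ k → p × 1# ≈ 0#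
  prime-power-characteristic p k q≡pᵏ = ^≈0⇒≈0 k (trans (sym (power-of-ones k)) (≡.subst (λ n → n × 1# ≈ 0#) q≡pᵏ card-vanishes))
    where
    power-of-ones : ∀ k → (p ℕ.^ k) × 1# ≈ (p × 1#) ^ k
    power-of-ones zero    = +-identityʳ 1#
    power-of-ones (suc k) = trans (×1-homo-* p (p ℕ.^ k)) (*-congˡ (power-of-ones k))

module Cyclic {c ℓ s} (F : FiniteField c ℓ (suc (suc s))) where
  open FiniteField F
  open FiniteFieldFacts F
  open AdditivePowers commRing using (1^m≈1)
  open import Algebra.Properties.CommutativeSemiring.Exp commutativeSemiring using (_^_; ^-congˡ; ^-homo-*; ^-assocʳ)
  open import Relation.Binary.Reasoning.Setoid setoid
  open import Data.Fin as Fin using (Fin; toℕ; fromℕ<; punchOut)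
  import Data.Fin.Properties as FinP
  open import Data.Integer as ℤ using (-[1+_])
  open import Data.Nat.DivMod using (_%_; m≡m%n+[m/n]*n; m%n<n)
  open import Data.Product using (∃; _×_; _,_; proj₁; proj₂)
  open import Function.Bundles using (Equivalence; mk⇔)
  open import Relation.Nullary using (yes; no)

  n : ℕ
  n = suc s

  -- Integer powers of an element of order dividing n are natural powers,
  -- x ^ -(k + 1) = x ^ ((k + 1) · s), and the exponents agree modulo every divisor r of n.
  ^ℤ-as-^ : ∀ {x} → x ^ n ≈ 1# → ∀ {r} → r ℕ∣.∣ n → ∀ i →
            ∃ λ m → x ^ℤ i ≈ x ^ m × (r ℕ∣.∣ ℤ.∣ i ∣ ⇔ r ℕ∣.∣ m)
  ^ℤ-as-^ {x} _ _ (+ k) = k , ^ℕ≈^ x k , mk⇔ (λ r∣k → r∣k) (λ r∣k → r∣k)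
  ^ℤ-as-^ {x} xⁿ≈1 {r} r∣n -[1+ k ] = suc k ℕ.* s , x⁻⁽ᵏ⁺¹⁾≈ , mk⇔ (ℕ∣.∣m+n∣m⇒∣n r∣sum) (ℕ∣.∣m+n∣m⇒∣n (≡.subst (r ℕ∣.∣_) (ℕP.+-comm (suc k) m) r∣sum))
    where
    m = suc k ℕ.* s
    sum≡ : suc k ℕ.+ m ≡ suc k ℕ.* n
    sum≡ = ≡.sym (ℕP.*-suc (suc k) s)
    r∣sum : r ℕ∣.∣ suc k ℕ.+ m
    r∣sum = ≡.subst (r ℕ∣.∣_) (≡.sym sum≡) (ℕ∣.∣-trans r∣n (ℕ∣.n∣m*n (suc k)))
    x⁻⁽ᵏ⁺¹⁾≈ : (x ^ℕ suc k) ⁻¹ ≈ x ^ m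
    x⁻⁽ᵏ⁺¹⁾≈ = sym (inverse-unique (begin
      x ^ℕ suc k * x ^ m    ≈⟨ *-congʳ (^ℕ≈^ x (suc k)) ⟩
      x ^ suc k * x ^ m     ≈⟨ ^-homo-* x (suc k) m ⟨
      x ^ (suc k ℕ.+ m)     ≡⟨ ≡.cong (x ^_) sum≡ ⟩
      x ^ (suc k ℕ.* n)     ≡⟨ ≡.cong (x ^_) (ℕP.*-comm (suc k) n) ⟩
      x ^ (n ℕ.* suc k)     ≈⟨ ^-assocʳ x n (suc k) ⟨
      (x ^ n) ^ suc k       ≈⟨ ^-congˡ (suc k) xⁿ≈1 ⟩
      1# ^ suc k            ≈⟨ 1^m≈1 (suc k) ⟩
      1#                    ∎))

  module Generator {α} (α-gen : IsGenerator α) where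

    α≉0 : ¬ α ≈ 0#
    α≉0 = proj₁ α-gen

    exponent : ∀ {y} → ¬ y ≈ 0# → ℕ
    exponent {y} y≉0 = proj₁ (proj₂ α-gen y y≉0)

    α^exponent : ∀ {y} (y≉0 : ¬ y ≈ 0#) → y ≈ α ^ exponent y≉0
    α^exponent {y} y≉0 = trans (proj₂ (proj₂ α-gen y y≉0)) (^ℕ≈^ α (exponent y≉0))

    ^-mod : ∀ t .{{_ : NonZero t}} → α ^ t ≈ 1# → ∀ k → α ^ k ≈ α ^ (k % t)
    ^-mod t αᵗ≈1 k = begin
      α ^ k                                ≡⟨ ≡.cong (α ^_) (≡.trans (m≡m%n+[m/n]*n k t) (≡.cong (k % t ℕ.+_) (ℕP.*-comm (k ℕ./ t) t))) ⟩
      α ^ (k % t ℕ.+ t ℕ.* (k ℕ./ t))      ≈⟨ ^-homo-* α (k % t) (t ℕ.* (k ℕ./ t)) ⟩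
      α ^ (k % t) * α ^ (t ℕ.* (k ℕ./ t))  ≈⟨ *-congˡ (^-assocʳ α t (k ℕ./ t)) ⟨
      α ^ (k % t) * (α ^ t) ^ (k ℕ./ t)    ≈⟨ *-congˡ (trans (^-congˡ (k ℕ./ t) αᵗ≈1) (1^m≈1 (k ℕ./ t))) ⟩
      α ^ (k % t) * 1#                     ≈⟨ *-identityʳ _ ⟩
      α ^ (k % t)                          ∎

    -- If α ^ t = 1 with t > 0 then n ≤ t: sending 0 to 0 and α ^ k to 1 + (k mod t)
    -- is an injection of the q = 1 + n field elements into Fin (1 + t).
    order-≥ : ∀ t .{{_ : NonZero t}} → α ^ t ≈ 1# → n ≤ t
    order-≥ t αᵗ≈1 = ℕP.≤-pred (FinP.injective⇒≤ {f = λ i → code (to i)} λ eq → to-injective (code-injective _ _ eq))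
      where
      code : Carrier → Fin (suc t)
      code y with y ≟ 0#
      ... | yes _   = Fin.zero
      ... | no y≉0 = Fin.suc (fromℕ< (m%n<n (exponent y≉0) t))

      code-injective : ∀ x y → code x ≡ code y → x ≈ y
      code-injective x y eq with x ≟ 0# | y ≟ 0#
      code-injective x y eq        | yes x≈0 | yes y≈0 = trans x≈0 (sym y≈0)
      code-injective x y ()        | yes _   | no _
      code-injective x y ()        | no _    | yes _
      code-injective x y eq        | no x≉0  | no y≉0  = begin
        x                       ≈⟨ α^exponent x≉0 ⟩
        α ^ exponent x≉0        ≈⟨ ^-mod t αᵗ≈1 _ ⟩
        α ^ (exponent x≉0 % t)  ≡⟨ ≡.cong (α ^_) same-residue ⟩
        α ^ (exponent y≉0 % t)  ≈⟨ ^-mod t αᵗ≈1 _ ⟨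
        α ^ exponent y≉0        ≈⟨ α^exponent y≉0 ⟨
        y                       ∎
        where
        same-residue : exponent x≉0 % t ≡ exponent y≉0 % t
        same-residue = ≡.trans (≡.sym (FinP.toℕ-fromℕ< _))
                         (≡.trans (≡.cong toℕ (FinP.suc-injective eq)) (FinP.toℕ-fromℕ< _))

    ^-gap : ∀ {a b} → a ≤ b → α ^ a ≈ α ^ b → α ^ (b ∸ a) ≈ 1#
    ^-gap {a} {b} a≤b αᵃ≈αᵇ = sym (*-cancelˡ (^-nonzero a α≉0) (begin
      α ^ a * 1#          ≈⟨ *-identityʳ _ ⟩
      α ^ a               ≈⟨ αᵃ≈αᵇ ⟩
      α ^ b               ≡⟨ ≡.cong (α ^_) (ℕP.m+[n∸m]≡n a≤b) ⟨
      α ^ (a ℕ.+ (b ∸ a)) ≈⟨ ^-homo-* α a (b ∸ a) ⟩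
      α ^ a * α ^ (b ∸ a) ∎))

    index-≢-zero : ∀ k → from 0# ≢ from (α ^ k)
    index-≢-zero k eq = ^-nonzero k α≉0 (from-injective (≡.sym eq))

    -- α ^ n = 1: the n + 1 non-zero powers α ^ 0, …, α ^ n cannot all differ, and
    -- the gap t between two equal ones satisfies 0 < t ≤ n and α ^ t = 1; so t = n.
    α^n≈1 : α ^ n ≈ 1#
    α^n≈1 with FinP.pigeonhole (ℕP.n<1+n n) (λ k → punchOut (index-≢-zero (toℕ k)))
    ... | i , j , i<j , same-index = ≡.subst (λ t → α ^ t ≈ 1#) gap≡n αᵗ≈1
      where
      a = toℕ i
      b = toℕ j
      αᵃ≈αᵇ : α ^ a ≈ α ^ b
      αᵃ≈αᵇ = from-injective (FinP.punchOut-injective (index-≢-zero a) (index-≢-zero b) same-index)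
      αᵗ≈1 : α ^ (b ∸ a) ≈ 1#
      αᵗ≈1 = ^-gap (ℕP.<⇒≤ i<j) αᵃ≈αᵇ
      gap≡n : b ∸ a ≡ n
      gap≡n = ℕP.≤-antisym (ℕP.≤-trans (ℕP.m∸n≤m b a) (ℕP.≤-pred (FinP.toℕ<n j)))
                           (order-≥ (b ∸ a) {{ℕ.>-nonZero (ℕP.m<n⇒0<n∸m i<j)}} αᵗ≈1)

    order : ∀ k → α ^ k ≈ 1# ⇔ n ℕ∣.∣ k
    order k = mk⇔ divides-k multiple-of-n
      where
      multiple-of-n : ∀ {k} → n ℕ∣.∣ k → α ^ k ≈ 1#
      multiple-of-n (divides t ≡.refl) = begin
        α ^ (t ℕ.* n)   ≡⟨ ≡.cong (α ^_) (ℕP.*-comm t n) ⟩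
        α ^ (n ℕ.* t)   ≈⟨ ^-assocʳ α n t ⟨
        (α ^ n) ^ t     ≈⟨ ^-congˡ t α^n≈1 ⟩
        1# ^ t          ≈⟨ 1^m≈1 t ⟩
        1#              ∎
      -- a non-zero remainder k mod n would be a positive t < n with α ^ t = 1
      divides-k : α ^ k ≈ 1# → n ℕ∣.∣ k
      divides-k αᵏ≈1 with k % n in k%n≡
      ... | zero  = ℕ∣.m%n≡0⇒n∣m k n k%n≡
      ... | suc t = ⊥-elim (ℕP.<⇒≱ (≡.subst (_< n) k%n≡ (m%n<n k n))
                      (order-≥ (suc t) (≡.subst (λ u → α ^ u ≈ 1#) k%n≡ (trans (sym (^-mod n α^n≈1 k)) αᵏ≈1))))

  -- Let n = r · N and Q = N + 1, so F_Q is the subfield of F fixed by x ↦ x ^ Q.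
  module Subfield (r N : ℕ) .{{_ : NonZero N}} (r*N≡n : r ℕ.* N ≡ n) where

    Q : ℕ
    Q = suc N

    r∣n : r ℕ∣.∣ n
    r∣n = divides N (≡.trans (≡.sym r*N≡n) (ℕP.*-comm r N))

    -- A power α ^ a of a generator lies in F_Q exactly when r divides a:
    -- (α ^ a) ^ Q = α ^ a  ⇔  α ^ (a · N) = 1  ⇔  r · N ∣ a · N  ⇔  r ∣ a.
    fixed⇔ : ∀ {α} → IsGenerator α → ∀ a → (α ^ a) ^ Q ≈ α ^ a ⇔ r ℕ∣.∣ a
    fixed⇔ {α} α-gen a = mk⇔
      (λ fixed → ℕ∣.*-cancelʳ-∣ N (n∣a*N (Equivalence.to (order (a ℕ.* N)) (αᵃᴺ≈1 fixed))))
      (λ r∣a → fixed-of-αᵃᴺ≈1 (Equivalence.from (order (a ℕ.* N)) (≡.subst (ℕ∣._∣ a ℕ.* N) r*N≡n (ℕ∣.*-monoˡ-∣ N r∣a))))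
      where
      open Generator α-gen
      n∣a*N : n ℕ∣.∣ a ℕ.* N → r ℕ.* N ℕ∣.∣ a ℕ.* N
      n∣a*N = ≡.subst (ℕ∣._∣ a ℕ.* N) (≡.sym r*N≡n)
      αᵃᴺ≈1 : (α ^ a) ^ Q ≈ α ^ a → α ^ (a ℕ.* N) ≈ 1#
      αᵃᴺ≈1 fixed = trans (sym (^-assocʳ α a N)) (*-cancelˡ (^-nonzero a α≉0) (trans fixed (sym (*-identityʳ _))))
      fixed-of-αᵃᴺ≈1 : α ^ (a ℕ.* N) ≈ 1# → (α ^ a) ^ Q ≈ α ^ a
      fixed-of-αᵃᴺ≈1 αᵃᴺ≈1 = trans (*-congˡ (trans (^-assocʳ α a N) αᵃᴺ≈1)) (*-identityʳ _)

    -- Assume moreover that x ↦ x ^ Q is additive, as it is when Q is a power of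
    -- the characteristic; then F_Q is closed under y ↦ 1 - y.
    module _ (frobenius-Q : AdditivePowers.Additive commRing Q) where
      open AdditivePowers commRing using (additive-fixed-1-)
      open import Algebra.Properties.Group +-group using (//-rightDividesʳ)

      transfer : ∀ {α β} → IsGenerator α → IsGenerator β → ∀ a b →
                 α ^ a + β ^ b ≈ 1# → r ℕ∣.∣ a → r ℕ∣.∣ b
      transfer {α} {β} α-gen β-gen a b sum≈1 r∣a = Equivalence.to (fixed⇔ β-gen b) (begin
        z ^ Q          ≈⟨ ^-congˡ Q z≈1-y ⟩
        (1# - y) ^ Q   ≈⟨ additive-fixed-1- Q frobenius-Q y (Equivalence.from (fixed⇔ α-gen a) r∣a) ⟩
        1# - y         ≈⟨ z≈1-y ⟨
        z              ∎)
        where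
        y = α ^ a
        z = β ^ b
        z≈1-y : z ≈ 1# - y
        z≈1-y = trans (sym (//-rightDividesʳ y z)) (+-congʳ (trans (+-comm z y) sum≈1))

      transferℤ : ∀ {α β} → IsGenerator α → IsGenerator β → ∀ (i j : ℤ) →
                  α ^ℤ i + β ^ℤ j ≈ 1# → (+ r) ∣ i → (+ r) ∣ j
      transferℤ {α} {β} α-gen β-gen i j sum≈1 r∣i =
        let a , αⁱ≈αᵃ , r∣i⇔r∣a = ^ℤ-as-^ (Generator.α^n≈1 α-gen) r∣n i
            b , βʲ≈βᵇ , r∣j⇔r∣b = ^ℤ-as-^ (Generator.α^n≈1 β-gen) r∣n j
        in  Equivalence.from r∣j⇔r∣b (transfer α-gen β-gen a b
              (trans (+-cong (sym αⁱ≈αᵃ) (sym βʲ≈βᵇ)) sum≈1) (Equivalence.to r∣i⇔r∣a r∣i))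

      theorem : ∀ α β → IsGenerator α → IsGenerator β → ∀ (i j : ℤ) →
                α ^ℤ i + β ^ℤ j ≈ 1# → (+ r) ∣ i ⇔ (+ r) ∣ j
      theorem α β α-gen β-gen i j sum≈1 = mk⇔
        (transferℤ α-gen β-gen i j sum≈1)
        (transferℤ β-gen α-gen j i (trans (+-comm (β ^ℤ j) (α ^ℤ i)) sum≈1))

finite-field-theorem : ∀ {c ℓ q} (F : FiniteField c ℓ q) (r N : ℕ) .{{_ : NonZero N}} →
  r ℕ.* N ≡ q ∸ 1 → AdditivePowers.Additive (FiniteField.commRing F) (suc N) →
  let open FiniteField F in
  ∀ α β → IsGenerator α → IsGenerator β → ∀ (i j : ℤ) →
  α ^ℤ i + β ^ℤ j ≈ 1# → (+ r) ∣ i ⇔ (+ r) ∣ j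
finite-field-theorem {q = zero}        F with FiniteFieldFacts.two≤q F
... | ()
finite-field-theorem {q = suc zero}    F with FiniteFieldFacts.two≤q F
... | s≤s ()
finite-field-theorem {q = suc (suc s)} F r N = Cyclic.Subfield.theorem F r N

-- Exponentiation of naturals, written unqualified in the statement below (opened
-- only here, as the ring modules above use _^_ for their own powers).
open import Data.Nat using (_^_)

-- Main theorem. With Q = p ^ d, N = Q - 1 and q = Q ^ e: N divides q - 1 with
-- quotient r, the field has characteristic p, so x ↦ x ^ Q = x ^ (p ^ d) is additive.
lemma3 : ∀ {c ℓ : Level} (p d e : ℕ) → Prime p → d ≥ 1 → e ≥ 1 →
    .{{_ : NonZero ((p ^ d) ∸ 1)}} →
    (F : FiniteField c ℓ ((p ^ d) ^ e)) →
    let open FiniteField F in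
    ∀ (α β : Carrier) → IsGenerator α → IsGenerator β →
    ∀ (i j : ℤ) → (α ^ℤ i) + (β ^ℤ j) ≈ 1# →
    ((+ ((((p ^ d) ^ e) ∸ 1) / ((p ^ d) ∸ 1))) ∣ i ⇔ (+ ((((p ^ d) ^ e) ∸ 1) / ((p ^ d) ∸ 1))) ∣ j)
lemma3 p d e p-prime _ _ F = finite-field-theorem F r N r*N≡q-1 frobenius-Q
  where
  open FiniteField F
  open AdditivePowers commRing using (Additive; additive-^; frobenius)
  open import Algebra.Properties.Semiring.Mult semiring using (_×_)
  Q = p ^ d
  N = Q ∸ 1
  r = (Q ^ e ∸ 1) / N
  1+N≡Q : suc N ≡ Q
  1+N≡Q = ℕP.suc-pred Q {{ℕ.≢-nonZero λ Q≡0 → ℕ.≢-nonZero⁻¹ N (≡.cong (_∸ 1) Q≡0)}}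
  r*N≡q-1 : r ℕ.* N ≡ Q ^ e ∸ 1
  r*N≡q-1 = m/n*n≡m (≡.subst (λ Q′ → N ℕ∣.∣ Q′ ^ e ∸ 1) 1+N≡Q (pred∣pred-pow N e))
  characteristic-p : p × 1# ≈ 0#
  characteristic-p = FiniteFieldFacts.prime-power-characteristic F p (d ℕ.* e) (ℕP.^-*-assoc p d e)
  frobenius-Q : Additive (suc N)
  frobenius-Q = ≡.subst Additive (≡.sym 1+N≡Q) (additive-^ p (frobenius p p-prime characteristic-p) d)
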